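{- The $\mathbb{Z}$-module $\Xi$ has a basis consisting of all shifted quasi-symmetric functions $\theta_\alpha$ such that $I(\alpha)$ contains no internal peak.
   Context: A composition $\alpha=[\alpha_1,\ldots,\alpha_k]$ of $n$ ($\alpha\vDash n$) is an ordered list of positive integers summing to $n$; $k(\alpha)=k$; the empty composition $0$ is the composition of $0$. $I(\alpha)=\{\alpha_1,\alpha_1+\alpha_2,\ldots,\alpha_1+\cdots+\alpha_{k-1}\}\subset[n-1]$, $A+1=\{a+1:a\in A\}$. $M_\alpha=\sum_{i_1<\cdots<i_k}x_{i_1}^{\alpha_1}\cdots x_{i_k}^{\alpha_k}$, $M_0=1$. For $\alpha\vDash n$, $\theta_\alpha=\sum_{\beta\vDash n,\ I(\alpha)\subset I(\beta)\cup(I(\beta)+1)}2^{k(\beta)}M_\beta$, $\theta_0=1$. $\theta_\alpha$ ($\alpha\vDash n$) is a shifted quasi-symmetric function if $n\le 1$ or $\alpha_1>1$. $\Xi$ is the $\mathbb{Z}$-span of all shifted quasi-symmetric functions. For such $\alpha\vDash n$, an internal peak of $I(\alpha)$ is an element $i\in I(\alpha)$ with $i-1\notin I(\alpha)$, $i+1\notin I(\alpha)$, and $i\in\{3,\ldots,n-2\}$. -}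

module Defs where

open import Data.Nat using (ℕ; zero; suc; _+_; _∸_; _^_; _≤_; _<_; _≡ᵇ_)
open import Data.Bool using (Bool; true; false; _∧_; _∨_; if_then_else_)
open import Data.List using (List; []; _∷_; map; length; foldr)
open import Data.Bool.ListAction using (any; all)
open import Data.Nat.ListAction using (sum)
open import Data.List.Relation.Unary.All using (All)
open import Data.List.Membership.Propositional using (_∈_)
open import Data.Integer using (ℤ; +_; 0ℤ) renaming (_*_ to _*ℤ_; _+_ to _+ℤ_)
open import Data.Product using (_×_; proj₁; proj₂)
open import Data.Sum using (_⊎_)
open import Data.Unit using (⊤)
open import Data.Empty using (⊥)
open import Relation.Nullary using (¬_)

IsComp : List ℕ → Set
IsComp α = All (λ a → 0 < a) α

size : List ℕ → ℕ
size = sum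

-- I(α) = {α₁, α₁+α₂, …, α₁+⋯+α_{k-1}}  (as a list)
I : List ℕ → List ℕ
I []            = []
I (a ∷ [])      = []
I (a ∷ b ∷ r)   = a ∷ map (λ x → a + x) (I (b ∷ r))

_∈ᵇ_ : ℕ → List ℕ → Bool
i ∈ᵇ xs = any (λ x → x ≡ᵇ i) xs

inShadowᵇ : ℕ → List ℕ → Bool
inShadowᵇ i β = (i ∈ᵇ I β) ∨ any (λ j → suc j ≡ᵇ i) (I β)

-- coefficient of M_β in θ_α:
-- 2^{k(β)} if β ⊨ |α| and I(α) ⊆ I(β) ∪ (I(β)+1), else 0
-- (a quasi-symmetric function is identified with its coefficient
--  function in the monomial basis M_β; β ranges over compositions)
θ : List ℕ → List ℕ → ℤ
θ α β =
  if (size α ≡ᵇ size β) ∧ all (λ i → inShadowᵇ i β) (I α)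
  then + (2 ^ length β) else 0ℤ

lincomb : List (ℤ × List ℕ) → List ℕ → ℤ
lincomb L β = foldr (λ p acc → proj₁ p *ℤ θ (proj₂ p) β +ℤ acc) 0ℤ L

-- θ_α (α ⊨ n) is a shifted quasi-symmetric function iff n ≤ 1 or α₁ > 1
Shifted : List ℕ → Set
Shifted []      = ⊤
Shifted (a ∷ r) = (a + sum r ≤ 1) ⊎ (1 < a)

NoInternalPeak : List ℕ → Set
NoInternalPeak α =
  (i : ℕ) → i ∈ I α → ¬ (i ∸ 1 ∈ I α) → ¬ (suc i ∈ I α) →
  3 ≤ i → i + 2 ≤ size α → ⊥

Basic : List ℕ → Set
Basic α = IsComp α × Shifted α × NoInternalPeak α

ShiftedComp : List ℕ → Set
ShiftedComp α = IsComp α × Shifted α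

-- A composition α of n is determined by its set of cut points I(α) ⊆ (0, n), and θ_α
-- only sees I(α) through the test I(α) ⊆ I(β) ∪ (I(β) + 1) (the shadow of β).
--
-- Spanning: if i ∈ I(α), every β passing the test for α has i − 1 or i + 1 in its
-- shadow, so by inclusion–exclusion θ_α = θ_{α∪{i−1}} + θ_{α∪{i+1}} − θ_{α∪{i−1,i+1}}.
-- At an internal peak i the three refinements are again shifted compositions with
-- strictly more cut points, and there are at most n of these, so repeating the step
-- writes every shifted θ_α in terms of peak-free ones.
--
-- Independence: for peak-free α let β = dual α, whose cut points are the x with both
-- x and x + 1 in I(α) ∪ {1, n}. Its shadow meets (1, n) exactly in I(α), because
-- only the internal peaks of I(α) are isolated in I(α) ∪ {1, n}. Hence a shifted θ_γ
-- with γ ⊨ n has a nonzero M_β-coefficient iff I(γ) ⊆ I(α). By induction on |I(α)|,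
-- every coefficient of a vanishing combination of peak-free θ's is zero.

module Submission where

open import Algebra.Bundles using (CommutativeMonoid)
open import Data.Bool using (Bool; true; false; T; _∧_; _∨_; if_then_else_)
open import Data.Bool.ListAction using (all)
open import Data.Bool.Properties
  using (T-∧; T-∨; ∨-assoc; ∨-idem; ∨-identityʳ; ∧-comm; ∧-zeroʳ; ∨-commutativeMonoid)
open import Algebra.Properties.CommutativeSemigroup
  (CommutativeMonoid.commutativeSemigroup ∨-commutativeMonoid) using (x∙yz≈y∙xz)
open import Data.Empty using (⊥; ⊥-elim)
open import Data.Integer using (ℤ; 0ℤ; 1ℤ; -1ℤ; -_)
  renaming (_+_ to _+ℤ_; _*_ to _*ℤ_; _-_ to _-ℤ_)
import Data.Integer.Properties as ℤ
open import Data.List using (List; []; _∷_; [_]; map; _++_; length)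
open import Data.List.Properties using (map-id; map-∘; map-cong)
open import Data.List.Membership.Propositional using (_∈_; _∉_; find; lose)
open import Data.List.Membership.Propositional.Properties using (∈-map⁺)
open import Data.List.Relation.Binary.Subset.Propositional using (_⊆_)
open import Data.List.Relation.Binary.Subset.Propositional.Properties using (All-resp-⊇)
open import Data.List.Relation.Unary.All as All using (All; []; _∷_)
open import Data.List.Relation.Unary.All.Properties using (all⁺; all⁻; ++⁺; map⁺)
open import Data.List.Relation.Unary.AllPairs using (_∷_)
open import Data.List.Relation.Unary.Any as Any using (here; there; any?)
open import Data.List.Relation.Unary.Any.Properties using (any⁺; any⁻)
open import Data.List.Relation.Unary.Unique.Propositional using (Unique)
open import Data.Nat using (ℕ; zero; suc; _+_; _∸_; _≤_; _<_; _≡ᵇ_; z≤n; s≤s;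
  compare; less; equal; greater; _≤?_)
open import Data.Nat.Induction using (<-wellFounded)
open import Data.Nat.Properties
open import Data.List.Membership.DecPropositional _≟_ using (_∉?_)
open import Data.Product using (_×_; _,_; proj₁; proj₂; map₂; ∃; ∃-syntax)
open import Data.Sum using (_⊎_; inj₁; inj₂; [_,_]′)
open import Defs
open import Function using (_∘_; _⇔_; mk⇔; id)
open import Function.Bundles using (Equivalence)
open import Induction.WellFounded using (WellFounded; Acc; acc; module Subrelation)
import Relation.Binary.Construct.On as On
open import Relation.Binary.PropositionalEquality hiding ([_])
open import Relation.Nullary using (¬_; yes; no)
open import Relation.Nullary.Decidable using (dec-true; dec-false; _×-dec_; T?)
import Relation.Unary as U

T-ext : ∀ {a b} → (T a → T b) → (T b → T a) → a ≡ b
T-ext {false} {false} _ _ = refl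
T-ext {false} {true}  _ g = ⊥-elim (g _)
T-ext {true}  {false} f _ = ⊥-elim (f _)
T-ext {true}  {true}  _ _ = refl

∨-cancelˡ : ∀ {a b c} → ¬ T a → a ∨ b ≡ a ∨ c → b ≡ c
∨-cancelˡ {false} _  b≡c = b≡c
∨-cancelˡ {true}  ¬a _   = ⊥-elim (¬a _)

T-∨ˡ : ∀ {a} b → T a → T (a ∨ b)
T-∨ˡ b t = Equivalence.from T-∨ (inj₁ t)

T-∨ʳ : ∀ a {b} → T b → T (a ∨ b)
T-∨ʳ a t = Equivalence.from (T-∨ {a}) (inj₂ t)

if-true : ∀ {A : Set} {b} {x y : A} → T b → (if b then x else y) ≡ x
if-true {b = true} _ = refl

if≢else : ∀ {A : Set} {b} {x y : A} → (if b then x else y) ≢ y → T b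
if≢else {b = true}  _  = _
if≢else {b = false} ne = ne refl

∈ᵇ⇒∈ : ∀ {x xs} → T (x ∈ᵇ xs) → x ∈ xs
∈ᵇ⇒∈ {x} {xs} = Any.map (λ {y} y≡x → sym (≡ᵇ⇒≡ y x y≡x)) ∘ any⁻ (_≡ᵇ x) xs

∈⇒∈ᵇ : ∀ {x xs} → x ∈ xs → T (x ∈ᵇ xs)
∈⇒∈ᵇ {x} = any⁺ (_≡ᵇ x) ∘ Any.map (λ {y} x≡y → ≡⇒≡ᵇ y x (sym x≡y))

all-cong-∈ᵇ : ∀ (p : ℕ → Bool) {xs ys} → (∀ x → x ∈ᵇ xs ≡ x ∈ᵇ ys) → all p xs ≡ all p ys
all-cong-∈ᵇ p {xs} {ys} same = T-ext (transfer ys⊆xs) (transfer xs⊆ys)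
  where
  xs⊆ys : xs ⊆ ys
  xs⊆ys x∈xs = ∈ᵇ⇒∈ (subst T (same _) (∈⇒∈ᵇ x∈xs))
  ys⊆xs : ys ⊆ xs
  ys⊆xs y∈ys = ∈ᵇ⇒∈ (subst T (sym (same _)) (∈⇒∈ᵇ y∈ys))
  transfer : ∀ {us vs} → vs ⊆ us → T (all p us) → T (all p vs)
  transfer {us} vs⊆us = all⁻ p ∘ All-resp-⊇ vs⊆us ∘ all⁺ p us

cutsFrom : ℕ → List ℕ → List ℕ
cutsFrom o []          = []
cutsFrom o (a ∷ [])    = []
cutsFrom o (a ∷ b ∷ r) = o + a ∷ cutsFrom (o + a) (b ∷ r)

map-+-I : ∀ o α → map (o +_) (I α) ≡ cutsFrom o α
map-+-I o []          = refl
map-+-I o (a ∷ [])    = refl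
map-+-I o (a ∷ b ∷ r) = cong (o + a ∷_) (begin
  map (o +_) (map (a +_) (I (b ∷ r)))  ≡⟨ map-∘ (I (b ∷ r)) ⟨
  map (λ x → o + (a + x)) (I (b ∷ r))  ≡⟨ map-cong (+-assoc o a) (I (b ∷ r)) ⟨
  map (o + a +_) (I (b ∷ r))           ≡⟨ map-+-I (o + a) (b ∷ r) ⟩
  cutsFrom (o + a) (b ∷ r)             ∎)
  where open ≡-Reasoning

I≡cutsFrom0 : ∀ α → I α ≡ cutsFrom 0 α
I≡cutsFrom0 α = trans (sym (map-id (I α))) (map-+-I 0 α)

isCut : List ℕ → ℕ → Bool
isCut α x = x ∈ᵇ I α

cutsFrom-∷ : ∀ o a ρ x → 0 < size ρ →
  x ∈ᵇ cutsFrom o (a ∷ ρ) ≡ (o + a ≡ᵇ x) ∨ (x ∈ᵇ cutsFrom (o + a) ρ)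
cutsFrom-∷ o a (_ ∷ _) x _ = refl

cutsFrom-bounds : ∀ o {a r x} → IsComp (a ∷ r) → T (x ∈ᵇ cutsFrom o (a ∷ r)) →
  o + a ≤ x × x < o + size (a ∷ r)
cutsFrom-bounds o {a} {b ∷ r} {x} (_ ∷ 0<b ∷ rest) x∈ with Equivalence.to (T-∨ {o + a ≡ᵇ x}) x∈
... | inj₁ o+a≡x = ≤-reflexive o+a≡ , subst (_< o + (a + size (b ∷ r))) o+a≡ o+a<end
  where
  o+a≡ : o + a ≡ x
  o+a≡ = ≡ᵇ⇒≡ (o + a) x o+a≡x
  o+a<end : o + a < o + (a + size (b ∷ r))
  o+a<end = +-monoʳ-< o (m<m+n a (≤-trans 0<b (m≤m+n b (size r))))
... | inj₂ x∈′ with cutsFrom-bounds (o + a) (0<b ∷ rest) x∈′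
...   | o+a+b≤x , x<end = ≤-trans (m≤m+n (o + a) b) o+a+b≤x , subst (x <_) (+-assoc o a _) x<end

isCut-bounds : ∀ {α x} → IsComp α → T (isCut α x) → 0 < x × x < size α
isCut-bounds {a ∷ r} {x} c@(0<a ∷ _) x∈ rewrite I≡cutsFrom0 (a ∷ r) =
  let a≤x , x<n = cutsFrom-bounds 0 c x∈ in ≤-trans 0<a a≤x , x<n

isCut-shifted : ∀ {α x} → IsComp α → Shifted α → T (isCut α x) → 1 < x
isCut-shifted {a ∷ r} {x} c (inj₂ 1<a) x∈ rewrite I≡cutsFrom0 (a ∷ r) =
  ≤-trans 1<a (proj₁ (cutsFrom-bounds 0 c x∈))
isCut-shifted {_ ∷ _} c (inj₁ n≤1) x∈ =
  let 0<x , x<n = isCut-bounds c x∈ in ⊥-elim (<⇒≱ (≤-trans (s≤s 0<x) x<n) n≤1)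

cutsFrom-first : ∀ o a b r → T ((o + a) ∈ᵇ cutsFrom o (a ∷ b ∷ r))
cutsFrom-first o a b r = ∈⇒∈ᵇ {xs = cutsFrom o (a ∷ b ∷ r)} (here refl)

cutsFrom-head : ∀ o {a b r c d s} → IsComp (a ∷ b ∷ r) → IsComp (c ∷ d ∷ s) →
  (∀ x → x ∈ᵇ cutsFrom o (a ∷ b ∷ r) ≡ x ∈ᵇ cutsFrom o (c ∷ d ∷ s)) → a ≡ c
cutsFrom-head o {a} {b} {r} {c} {d} {s} γ-comp α-comp same = +-cancelˡ-≡ o a c (≤-antisym
  (proj₁ (cutsFrom-bounds o γ-comp (subst T (sym (same (o + c))) (cutsFrom-first o c d s))))
  (proj₁ (cutsFrom-bounds o α-comp (subst T (same (o + a)) (cutsFrom-first o a b r)))))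

cutsFrom-tail : ∀ o {a b r c d s} → a ≡ c → IsComp (b ∷ r) → IsComp (d ∷ s) →
  (∀ x → x ∈ᵇ cutsFrom o (a ∷ b ∷ r) ≡ x ∈ᵇ cutsFrom o (c ∷ d ∷ s)) →
  ∀ x → x ∈ᵇ cutsFrom (o + a) (b ∷ r) ≡ x ∈ᵇ cutsFrom (o + a) (d ∷ s)
cutsFrom-tail o {a} refl γ-comp α-comp same x with o + a ≟ x
... | no  o+a≢x = ∨-cancelˡ (o+a≢x ∘ ≡ᵇ⇒≡ (o + a) x) (same x)
... | yes refl  = T-ext (⊥-elim ∘ beyond γ-comp) (⊥-elim ∘ beyond α-comp)
  where
  beyond : ∀ {b r} → IsComp (b ∷ r) → ¬ T ((o + a) ∈ᵇ cutsFrom (o + a) (b ∷ r))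
  beyond comp@(0<b ∷ _) o+a∈ = <⇒≱ (m<m+n (o + a) 0<b) (proj₁ (cutsFrom-bounds (o + a) comp o+a∈))

cutsFrom-injective : ∀ o {γ α} → IsComp γ → IsComp α → size γ ≡ size α →
  (∀ x → x ∈ᵇ cutsFrom o γ ≡ x ∈ᵇ cutsFrom o α) → γ ≡ α
cutsFrom-injective o {[]} {[]} _ _ _ _ = refl
cutsFrom-injective o {[]} {a ∷ _} _ (0<a ∷ _) n≡ _ = ⊥-elim (<⇒≢ (≤-trans 0<a (m≤m+n a _)) n≡)
cutsFrom-injective o {a ∷ _} {[]} (0<a ∷ _) _ n≡ _ = ⊥-elim (<⇒≢ (≤-trans 0<a (m≤m+n a _)) (sym n≡))
cutsFrom-injective o {a ∷ []} {c ∷ []} _ _ n≡ _ =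
  cong [_] (trans (sym (+-identityʳ a)) (trans n≡ (+-identityʳ c)))
cutsFrom-injective o {a ∷ []} {c ∷ d ∷ s} _ _ _ same =
  ⊥-elim (subst T (sym (same (o + c))) (cutsFrom-first o c d s))
cutsFrom-injective o {a ∷ b ∷ r} {c ∷ []} _ _ _ same =
  ⊥-elim (subst T (same (o + a)) (cutsFrom-first o a b r))
cutsFrom-injective o {a ∷ b ∷ r} {c ∷ d ∷ s} γ-comp@(_ ∷ b-comp) α-comp@(_ ∷ d-comp) n≡ same =
  cong₂ _∷_ a≡c (cutsFrom-injective (o + a) b-comp d-comp tail-sizes
                  (cutsFrom-tail o a≡c b-comp d-comp same))
  where
  a≡c : a ≡ c
  a≡c = cutsFrom-head o γ-comp α-comp same
  tail-sizes : size (b ∷ r) ≡ size (d ∷ s)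
  tail-sizes = +-cancelˡ-≡ a _ _ (trans n≡ (cong (_+ size (d ∷ s)) (sym a≡c)))

isCut-injective : ∀ {γ α} → IsComp γ → IsComp α → size γ ≡ size α →
  (∀ x → isCut γ x ≡ isCut α x) → γ ≡ α
isCut-injective {γ} {α} γ-comp α-comp n≡ same =
  cutsFrom-injective 0 γ-comp α-comp n≡ (λ x → subst₂ (λ u v → x ∈ᵇ u ≡ x ∈ᵇ v)
    (I≡cutsFrom0 γ) (I≡cutsFrom0 α) (same x))

cut : ℕ → List ℕ → List ℕ
cut j []      = []
cut j (a ∷ r) with compare j a
... | less _ k    = j ∷ suc k ∷ r
... | equal _     = a ∷ r
... | greater _ k = a ∷ cut (suc k) r

size-cut : ∀ j α → size (cut j α) ≡ size α
size-cut j []      = refl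
size-cut j (a ∷ r) with compare j a
... | less _ k    = trans (sym (+-assoc j (suc k) (size r))) (cong (_+ size r) (+-suc j k))
... | equal _     = refl
... | greater _ k = cong (a +_) (size-cut (suc k) r)

isComp-cut : ∀ {j α} → 0 < j → IsComp α → IsComp (cut j α)
isComp-cut _ [] = []
isComp-cut {j} {a ∷ r} 0<j (0<a ∷ c) with compare j a
... | less _ k    = 0<j ∷ s≤s z≤n ∷ c
... | equal _     = 0<a ∷ c
... | greater _ k = 0<a ∷ isComp-cut (s≤s z≤n) c

shifted-cut : ∀ {j α} → 1 < j → j < size α → Shifted α → Shifted (cut j α)
shifted-cut {j} {a ∷ r} 1<j _ (inj₂ 1<a) with compare j a
... | less _ _    = inj₂ 1<j
... | equal _     = inj₂ 1<a
... | greater _ _ = inj₂ 1<a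
shifted-cut {j} {_ ∷ _} 1<j j<n (inj₁ n≤1) = ⊥-elim (<⇒≱ (<-trans 1<j j<n) n≤1)

cutsFrom-shift : ∀ p q c d r → p + c ≡ q + d → cutsFrom p (c ∷ r) ≡ cutsFrom q (d ∷ r)
cutsFrom-shift _ _ _ _ []      _ = refl
cutsFrom-shift _ _ _ _ (_ ∷ _) e rewrite e = refl

cutsFrom-cut : ∀ o j α x → j < size α →
  x ∈ᵇ cutsFrom o (cut j α) ≡ (o + j ≡ᵇ x) ∨ (x ∈ᵇ cutsFrom o α)
cutsFrom-cut o j (a ∷ r) x j<n with compare j a
... | less _ k = cong (λ l → (o + j ≡ᵇ x) ∨ (x ∈ᵇ l))
  (cutsFrom-shift (o + j) o (suc k) (suc (j + k)) r
    (trans (+-assoc o j (suc k)) (cong (o +_) (+-suc j k))))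
... | equal _ = begin
  x ∈ᵇ cutsFrom o (j ∷ r)                         ≡⟨ cutsFrom-∷ o j r x 0<r ⟩
  (o + j ≡ᵇ x) ∨ rest                             ≡⟨ cong (_∨ rest) (∨-idem (o + j ≡ᵇ x)) ⟨
  ((o + j ≡ᵇ x) ∨ (o + j ≡ᵇ x)) ∨ rest            ≡⟨ ∨-assoc (o + j ≡ᵇ x) _ rest ⟩
  (o + j ≡ᵇ x) ∨ ((o + j ≡ᵇ x) ∨ rest)            ≡⟨ cong ((o + j ≡ᵇ x) ∨_) (cutsFrom-∷ o j r x 0<r) ⟨
  (o + j ≡ᵇ x) ∨ (x ∈ᵇ cutsFrom o (j ∷ r))        ∎
  where
  open ≡-Reasoning
  rest : Bool
  rest = x ∈ᵇ cutsFrom (o + j) r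
  0<r : 0 < size r
  0<r = +-cancelˡ-< j 0 (size r) (subst (_< j + size r) (sym (+-identityʳ j)) j<n)
... | greater _ k = begin
  x ∈ᵇ cutsFrom o (a ∷ cut (suc k) r)
    ≡⟨ cutsFrom-∷ o a (cut (suc k) r) x (subst (0 <_) (sym (size-cut (suc k) r)) 0<r) ⟩
  (o + a ≡ᵇ x) ∨ (x ∈ᵇ cutsFrom (o + a) (cut (suc k) r))
    ≡⟨ cong ((o + a ≡ᵇ x) ∨_) (cutsFrom-cut (o + a) (suc k) r x k<r) ⟩
  (o + a ≡ᵇ x) ∨ ((o + a + suc k ≡ᵇ x) ∨ (x ∈ᵇ cutsFrom (o + a) r))
    ≡⟨ x∙yz≈y∙xz (o + a ≡ᵇ x) (o + a + suc k ≡ᵇ x) (x ∈ᵇ cutsFrom (o + a) r) ⟩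
  (o + a + suc k ≡ᵇ x) ∨ ((o + a ≡ᵇ x) ∨ (x ∈ᵇ cutsFrom (o + a) r))
    ≡⟨ cong₂ (λ i b → (i ≡ᵇ x) ∨ b) (sym o+a+k+1≡o+j) (cutsFrom-∷ o a r x 0<r) ⟨
  (o + suc (a + k) ≡ᵇ x) ∨ (x ∈ᵇ cutsFrom o (a ∷ r))
    ∎
  where
  open ≡-Reasoning
  k<r : suc k < size r
  k<r = +-cancelˡ-< a (suc k) (size r) (subst (_< a + size r) (sym (+-suc a k)) j<n)
  0<r : 0 < size r
  0<r = <-trans (s≤s z≤n) k<r
  o+a+k+1≡o+j : o + a + suc k ≡ o + suc (a + k)
  o+a+k+1≡o+j = trans (+-assoc o a (suc k)) (cong (o +_) (+-suc a k))

isCut-cut : ∀ j α x → j < size α → isCut (cut j α) x ≡ (j ≡ᵇ x) ∨ isCut α x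
isCut-cut j α x j<n rewrite I≡cutsFrom0 (cut j α) | I≡cutsFrom0 α = cutsFrom-cut 0 j α x j<n

isCut-cut-self : ∀ {j α} → j < size α → T (isCut (cut j α) j)
isCut-cut-self {j} {α} j<n = subst T (sym (isCut-cut j α j j<n)) (T-∨ˡ (isCut α j) (≡⇒≡ᵇ j j refl))

isCut-cut-mono : ∀ {j α x} → j < size α → T (isCut α x) → T (isCut (cut j α) x)
isCut-cut-mono {j} {α} {x} j<n = subst T (sym (isCut-cut j α x j<n)) ∘ T-∨ʳ (j ≡ᵇ x)

∉-cut : ∀ {j α x} → j ≢ x → j < size α → x ∉ I α → x ∉ I (cut j α)
∉-cut {j} {α} {x} j≢x j<n x∉ x∈ =
  [ j≢x ∘ ≡ᵇ⇒≡ j x , x∉ ∘ ∈ᵇ⇒∈ ]′ (Equivalence.to T-∨ (subst T (isCut-cut j α x j<n) (∈⇒∈ᵇ x∈)))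

bit : Bool → ℕ
bit false = 0
bit true  = 1

count : (ℕ → Bool) → ℕ → ℕ
count p zero    = 0
count p (suc n) = bit (p n) + count p n

bit≤1 : ∀ a → bit a ≤ 1
bit≤1 false = z≤n
bit≤1 true  = ≤-refl

bit-mono : ∀ {a b} → (T a → T b) → bit a ≤ bit b
bit-mono {false}         _   = z≤n
bit-mono {true}  {true}  _   = ≤-refl
bit-mono {true}  {false} a⇒b = ⊥-elim (a⇒b _)

bit-< : ∀ {a b} → ¬ T a → T b → bit a < bit b
bit-< {false} {true} _  _ = ≤-refl
bit-< {true}         ¬a _ = ⊥-elim (¬a _)

count≤ : ∀ p n → count p n ≤ n
count≤ p zero    = z≤n
count≤ p (suc n) = +-mono-≤ (bit≤1 (p n)) (count≤ p n)

count-mono : ∀ {p q} n → T ∘ p U.⊆ T ∘ q → count p n ≤ count q n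
count-mono zero    _   = z≤n
count-mono (suc n) p⊆q = +-mono-≤ (bit-mono p⊆q) (count-mono n p⊆q)

count-mono-< : ∀ {p q n x} → T ∘ p U.⊆ T ∘ q → x < n → ¬ T (p x) → T (q x) → count p n < count q n
count-mono-< {n = suc n} {x} p⊆q x<1+n ¬px qx with x ≟ n
... | yes refl = +-mono-<-≤ (bit-< ¬px qx) (count-mono n p⊆q)
... | no  x≢n  = +-mono-≤-< (bit-mono p⊆q) (count-mono-< p⊆q (≤∧≢⇒< (≤-pred x<1+n) x≢n) ¬px qx)

count-≡⇒⊇ : ∀ {p q n x} → T ∘ p U.⊆ T ∘ q → count p n ≡ count q n → x < n → T (q x) → T (p x)
count-≡⇒⊇ {p} {x = x} p⊆q same x<n qx with T? (p x)
... | yes px  = px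
... | no  ¬px = ⊥-elim (<⇒≢ (count-mono-< p⊆q x<n ¬px qx) same)

cuts : List ℕ → ℕ
cuts α = count (isCut α) (size α)

record _⊐_ (γ α : List ℕ) : Set where
  constructor refines
  field
    same-size : size γ ≡ size α
    more-cuts : cuts α < cuts γ

⊐-trans : ∀ {α β γ} → γ ⊐ β → β ⊐ α → γ ⊐ α
⊐-trans (refines n≡ more) (refines n≡′ more′) = refines (trans n≡ n≡′) (<-trans more′ more)

cut-⊐ : ∀ {j α} → j < size α → j ∉ I α → cut j α ⊐ α
cut-⊐ {j} {α} j<n j∉ = refines (size-cut j α) (
  subst (λ n → cuts α < count (isCut (cut j α)) n) (sym (size-cut j α))
    (count-mono-< (isCut-cut-mono {α = α} j<n) j<n (j∉ ∘ ∈ᵇ⇒∈) (isCut-cut-self {α = α} j<n)))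

headroom : List ℕ → ℕ
headroom α = size α ∸ cuts α

⊐⇒headroom< : ∀ {γ α} → γ ⊐ α → headroom γ < headroom α
⊐⇒headroom< {γ} {α} (refines n≡ more) = subst (λ n → n ∸ cuts γ < size α ∸ cuts α) (sym n≡)
  (∸-monoʳ-< more (subst (cuts γ ≤_) n≡ (count≤ (isCut γ) (size γ))))

⊐-wellFounded : WellFounded _⊐_
⊐-wellFounded =
  Subrelation.wellFounded (λ {γ α} → ⊐⇒headroom< {γ} {α}) (On.wellFounded headroom <-wellFounded)

-- Inclusion–exclusion at a cut point

covered : List ℕ → List ℕ → Bool
covered α β = all (λ i → inShadowᵇ i β) (I α)

covered-cut : ∀ j α β → j < size α → covered (cut j α) β ≡ covered α β ∧ inShadowᵇ j β
covered-cut j α β j<n =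
  trans (all-cong-∈ᵇ (λ i → inShadowᵇ i β) {I (cut j α)} {j ∷ I α} (λ x → isCut-cut j α x j<n))
        (∧-comm (inShadowᵇ j β) (covered α β))

shadow-spread : ∀ y β → T (inShadowᵇ (suc y) β) → T (inShadowᵇ y β ∨ inShadowᵇ (suc (suc y)) β)
shadow-spread y β y+1∈ with Equivalence.to (T-∨ {isCut β (suc y)}) y+1∈
... | inj₁ y+1∈I = T-∨ʳ (inShadowᵇ y β) (T-∨ʳ (isCut β (suc (suc y))) y+1∈I)
... | inj₂ y∈I   = T-∨ˡ (inShadowᵇ (suc (suc y)) β) (T-∨ˡ _ y∈I)

if-inclusion-exclusion : ∀ s a p q (w : ℤ) → (T a → T (p ∨ q)) →
  (if s ∧ a then w else 0ℤ) ≡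
  (if s ∧ (a ∧ p) then w else 0ℤ) +ℤ (if s ∧ (a ∧ q) then w else 0ℤ)
    -ℤ (if s ∧ ((a ∧ p) ∧ q) then w else 0ℤ)
if-inclusion-exclusion false _     _     _     _ _   = refl
if-inclusion-exclusion true  false _     _     _ _   = refl
if-inclusion-exclusion true  true  false false _ p∨q = ⊥-elim (p∨q _)
if-inclusion-exclusion true  true  false true  w _   =
  sym (trans (ℤ.+-identityʳ (0ℤ +ℤ w)) (ℤ.+-identityˡ w))
if-inclusion-exclusion true  true  true  false w _   =
  sym (trans (ℤ.+-identityʳ (w +ℤ 0ℤ)) (ℤ.+-identityʳ w))
if-inclusion-exclusion true  true  true  true  w _   =
  sym (trans (ℤ.+-assoc w w (- w)) (trans (cong (w +ℤ_) (ℤ.+-inverseʳ w)) (ℤ.+-identityʳ w)))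

θ-split : ∀ {h α} β → suc h ∈ I α → suc (suc h) < size α →
  θ α β ≡ θ (cut h α) β +ℤ θ (cut (suc (suc h)) α) β -ℤ θ (cut (suc (suc h)) (cut h α)) β
θ-split {h} {α} β h+1∈ h+2<n
  rewrite size-cut (suc (suc h)) (cut h α) | size-cut h α | size-cut (suc (suc h)) α
        | covered-cut (suc (suc h)) (cut h α) β (subst (suc (suc h) <_) (sym (size-cut h α)) h+2<n)
        | covered-cut h α β (<-trans (m<n⇒m<1+n (n<1+n h)) h+2<n)
        | covered-cut (suc (suc h)) α β h+2<n
  = if-inclusion-exclusion (size α ≡ᵇ size β) (covered α β) (inShadowᵇ h β)
      (inShadowᵇ (suc (suc h)) β) _ (shadow-spread h β ∘ λ c → All.lookup (all⁺ _ (I α) c) h+1∈)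

-- Spanning

Spanned : (List ℕ → ℤ) → Set
Spanned f = ∃[ L ] All (λ p → Basic (proj₂ p)) L × (∀ β → f β ≡ lincomb L β)

scale : ℤ → List (ℤ × List ℕ) → List (ℤ × List ℕ)
scale c = map (λ p → c *ℤ proj₁ p , proj₂ p)

lincomb-++ : ∀ L M β → lincomb (L ++ M) β ≡ lincomb L β +ℤ lincomb M β
lincomb-++ []      M β = sym (ℤ.+-identityˡ _)
lincomb-++ (p ∷ L) M β = trans (cong (proj₁ p *ℤ θ (proj₂ p) β +ℤ_) (lincomb-++ L M β))
                               (sym (ℤ.+-assoc (proj₁ p *ℤ θ (proj₂ p) β) _ _))

lincomb-scale : ∀ c L β → lincomb (scale c L) β ≡ c *ℤ lincomb L β
lincomb-scale c []      β = sym (ℤ.*-zeroʳ c)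
lincomb-scale c (p ∷ L) β =
  trans (cong₂ _+ℤ_ (ℤ.*-assoc c (proj₁ p) (θ (proj₂ p) β)) (lincomb-scale c L β))
        (sym (ℤ.*-distribˡ-+ c _ _))

spanned-cong : ∀ {f g} → (∀ β → f β ≡ g β) → Spanned g → Spanned f
spanned-cong f≗g (L , L-basic , g≡) = L , L-basic , λ β → trans (f≗g β) (g≡ β)

spanned-θ : ∀ {α} → Basic α → Spanned (θ α)
spanned-θ {α} basic = [ 1ℤ , α ] , basic ∷ [] , λ β → sym (trans (ℤ.+-identityʳ _) (ℤ.*-identityˡ _))

spanned-+ : ∀ {f g} → Spanned f → Spanned g → Spanned (λ β → f β +ℤ g β)
spanned-+ (L , L-basic , f≡) (M , M-basic , g≡) =
  L ++ M , ++⁺ L-basic M-basic , λ β → trans (cong₂ _+ℤ_ (f≡ β) (g≡ β)) (sym (lincomb-++ L M β))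

spanned-* : ∀ {f} c → Spanned f → Spanned (λ β → c *ℤ f β)
spanned-* c (L , L-basic , f≡) =
  scale c L , map⁺ L-basic , λ β → trans (cong (c *ℤ_) (f≡ β)) (sym (lincomb-scale c L β))

spanned-− : ∀ {f g} → Spanned f → Spanned g → Spanned (λ β → f β -ℤ g β)
spanned-− {f} {g} f-span g-span =
  spanned-cong (λ β → cong (f β +ℤ_) (sym (ℤ.-1*i≡-i (g β)))) (spanned-+ f-span (spanned-* -1ℤ g-span))

InternalPeak : List ℕ → ℕ → Set
InternalPeak α i = i ∈ I α × i ∸ 1 ∉ I α × suc i ∉ I α × 3 ≤ i × i + 2 ≤ size α

internalPeak? : ∀ α → ∃ (InternalPeak α) ⊎ NoInternalPeak α
internalPeak? α
  with any? (λ i → (i ∸ 1 ∉? I α) ×-dec (suc i ∉? I α) ×-dec (3 ≤? i) ×-dec (i + 2 ≤? size α)) (I α)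
... | yes peak = let i , i∈ , conditions = find peak in inj₁ (i , i∈ , conditions)
... | no  none = inj₂ λ i i∈ c₁ c₂ c₃ c₄ → none (lose i∈ (c₁ , c₂ , c₃ , c₄))

refine : ∀ {j α} → 1 < j → j < size α → j ∉ I α → ShiftedComp α → ShiftedComp (cut j α) × cut j α ⊐ α
refine 1<j j<n j∉ (comp , shifted) =
  (isComp-cut (<-trans (s≤s z≤n) 1<j) comp , shifted-cut 1<j j<n shifted) , cut-⊐ j<n j∉

θ-spanned : ∀ α → ShiftedComp α → Spanned (θ α)
θ-spanned α = go α (⊐-wellFounded α)
  where
  go : ∀ α → Acc _⊐_ α → ShiftedComp α → Spanned (θ α)
  go α (acc rec) sc with internalPeak? α
  ... | inj₂ none = spanned-θ (proj₁ sc , proj₂ sc , none)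
  ... | inj₁ (zero , _ , _ , _ , () , _)
  ... | inj₁ (suc h , h+1∈ , h∉ , h+2∉ , s≤s 1<h , h+3≤n) =
    spanned-cong (λ β → θ-split β h+1∈ h+2<n)
      (spanned-− (spanned-+ (go _ (rec (proj₂ at-h)) (proj₁ at-h))
                            (go _ (rec (proj₂ at-h+2)) (proj₁ at-h+2)))
                 (go _ (rec (⊐-trans (proj₂ at-both) (proj₂ at-h))) (proj₁ at-both)))
    where
    h+2<n : suc (suc h) < size α
    h+2<n = subst (_≤ size α) (cong suc (+-comm h 2)) h+3≤n
    h<h+2 : h < suc (suc h)
    h<h+2 = m<n⇒m<1+n (n<1+n h)
    at-h : ShiftedComp (cut h α) × cut h α ⊐ α
    at-h = refine 1<h (<-trans h<h+2 h+2<n) h∉ sc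
    at-h+2 : ShiftedComp (cut (suc (suc h)) α) × cut (suc (suc h)) α ⊐ α
    at-h+2 = refine (s≤s (s≤s z≤n)) h+2<n h+2∉ sc
    at-both : ShiftedComp (cut (suc (suc h)) (cut h α)) × cut (suc (suc h)) (cut h α) ⊐ cut h α
    at-both = refine (s≤s (s≤s z≤n)) (subst (suc (suc h) <_) (sym (size-cut h α)) h+2<n)
                (∉-cut (<⇒≢ h<h+2) (<-trans h<h+2 h+2<n) h+2∉) (proj₁ at-h)

lincomb-spanned : ∀ L → All (λ p → ShiftedComp (proj₂ p)) L → Spanned (lincomb L)
lincomb-spanned []            []         = [] , [] , λ _ → refl
lincomb-spanned ((c , α) ∷ L) (sc ∷ scs) =
  spanned-+ (spanned-* c (θ-spanned α sc)) (lincomb-spanned L scs)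

-- Independence

cutAll : (ℕ → Bool) → ℕ → List ℕ → List ℕ
cutAll p zero    γ = γ
cutAll p (suc m) γ = if p (suc m) then cut (suc m) (cutAll p m γ) else cutAll p m γ

size-cutAll : ∀ p m γ → size (cutAll p m γ) ≡ size γ
size-cutAll p zero    γ = refl
size-cutAll p (suc m) γ with p (suc m)
... | true  = trans (size-cut (suc m) (cutAll p m γ)) (size-cutAll p m γ)
... | false = size-cutAll p m γ

isComp-cutAll : ∀ p m {γ} → IsComp γ → IsComp (cutAll p m γ)
isComp-cutAll p zero    γ-comp = γ-comp
isComp-cutAll p (suc m) γ-comp with p (suc m)
... | true  = isComp-cut (s≤s z≤n) (isComp-cutAll p m γ-comp)
... | false = isComp-cutAll p m γ-comp

isCut-cutAll-skip : ∀ p m γ x → suc m < size γ → suc m ≢ x →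
  isCut (cutAll p (suc m) γ) x ≡ isCut (cutAll p m γ) x
isCut-cutAll-skip p m γ x m<n m≢x with p (suc m)
... | true  = trans (isCut-cut (suc m) (cutAll p m γ) x (subst (suc m <_) (sym (size-cutAll p m γ)) m<n))
                    (cong (_∨ isCut (cutAll p m γ) x) (dec-false (suc m ≟ x) m≢x))
... | false = refl

isCut-cutAll-above : ∀ p m γ x → m < size γ → m < x → isCut (cutAll p m γ) x ≡ isCut γ x
isCut-cutAll-above p zero    γ x _   _   = refl
isCut-cutAll-above p (suc m) γ x m<n m<x = trans (isCut-cutAll-skip p m γ x m<n (<⇒≢ m<x))
  (isCut-cutAll-above p m γ x (<-trans (n<1+n m) m<n) (<-trans (n<1+n m) m<x))

isCut-cutAll : ∀ p m γ x → m < size γ → 0 < x → x ≤ m → isCut (cutAll p m γ) x ≡ p x ∨ isCut γ x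
isCut-cutAll p zero    γ x _   0<x x≤0 = ⊥-elim (<⇒≱ 0<x x≤0)
isCut-cutAll p (suc m) γ x m<n 0<x x≤m with x ≟ suc m
... | no x≢ = trans (isCut-cutAll-skip p m γ x m<n (x≢ ∘ sym))
  (isCut-cutAll p m γ x (<-trans (n<1+n m) m<n) 0<x (≤-pred (≤∧≢⇒< x≤m x≢)))
... | yes refl with p (suc m)
...   | true  = trans (isCut-cut (suc m) (cutAll p m γ) (suc m)
                        (subst (suc m <_) (sym (size-cutAll p m γ)) m<n))
                      (cong (_∨ isCut (cutAll p m γ) (suc m)) (dec-true (suc m ≟ suc m) refl))
...   | false = isCut-cutAll-above p m γ (suc m) (<-trans (n<1+n m) m<n) (n<1+n m)

fromCuts : ℕ → (ℕ → Bool) → List ℕ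
fromCuts zero    p = []
fromCuts (suc n) p = cutAll p n [ suc n ]

isComp-fromCuts : ∀ n p → IsComp (fromCuts n p)
isComp-fromCuts zero    p = []
isComp-fromCuts (suc n) p = isComp-cutAll p n (s≤s z≤n ∷ [])

size-fromCuts : ∀ n p → size (fromCuts n p) ≡ n
size-fromCuts zero    p = refl
size-fromCuts (suc n) p = trans (size-cutAll p n [ suc n ]) (+-identityʳ (suc n))

isCut-fromCuts : ∀ n p {x} → 0 < x → x < n → isCut (fromCuts n p) x ≡ p x
isCut-fromCuts (suc n) p {x} 0<x x<n =
  trans (isCut-cutAll p n [ suc n ] x (s≤s (m≤m+n n 0)) 0<x (≤-pred x<n)) (∨-identityʳ (p x))

dualCut : List ℕ → ℕ → Bool
dualCut α x = (isCut α x ∨ (x ≡ᵇ 1)) ∧ (isCut α (suc x) ∨ (suc x ≡ᵇ size α))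

dual : List ℕ → List ℕ
dual α = fromCuts (size α) (dualCut α)

has-neighbour-unless-isolated : ∀ a a⁺ a⁻ e₁ eₙ → (T a → ¬ T a⁻ → ¬ T a⁺ → ¬ T e₁ → ¬ T eₙ → ⊥) →
  ((a ∨ false) ∧ (a⁺ ∨ eₙ)) ∨ ((a⁻ ∨ e₁) ∧ (a ∨ false)) ≡ a
has-neighbour-unless-isolated false _     _     _     _     _        = ∧-zeroʳ _
has-neighbour-unless-isolated true  true  _     _     _     _        = refl
has-neighbour-unless-isolated true  false _     _     true  _        = refl
has-neighbour-unless-isolated true  false true  _     false _        = refl
has-neighbour-unless-isolated true  false false true  false _        = refl
has-neighbour-unless-isolated true  false false false false isolated = ⊥-elim (isolated _ id id id id)

shadow-dual : ∀ {α y} → NoInternalPeak α → 1 < y → y < size α → inShadowᵇ y (dual α) ≡ isCut α y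
shadow-dual {y = suc zero} _ (s≤s ()) _
shadow-dual {α} {suc (suc w)} noPeak _ y<n = begin
  inShadowᵇ (suc z) (dual α)
    ≡⟨⟩
  isCut (dual α) (suc z) ∨ isCut (dual α) z
    ≡⟨ cong₂ _∨_ (isCut-fromCuts n (dualCut α) (s≤s z≤n) y<n)
                 (isCut-fromCuts n (dualCut α) (s≤s z≤n) (<-trans (n<1+n z) y<n)) ⟩
  dualCut α (suc z) ∨ dualCut α z
    ≡⟨ cong (λ e → dualCut α (suc z) ∨ ((isCut α z ∨ (z ≡ᵇ 1)) ∧ (isCut α (suc z) ∨ e)))
            (dec-false (suc z ≟ n) (<⇒≢ y<n)) ⟩
  ((isCut α (suc z) ∨ false) ∧ (isCut α (suc (suc z)) ∨ (suc (suc z) ≡ᵇ n)))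
    ∨ ((isCut α z ∨ (z ≡ᵇ 1)) ∧ (isCut α (suc z) ∨ false))
    ≡⟨ has-neighbour-unless-isolated _ _ _ _ _ notPeak ⟩
  isCut α (suc z) ∎
  where
  open ≡-Reasoning
  z = suc w
  n = size α
  notPeak : T (isCut α (suc z)) → ¬ T (isCut α z) → ¬ T (isCut α (suc (suc z))) →
            ¬ T (z ≡ᵇ 1) → ¬ T (suc (suc z) ≡ᵇ n) → ⊥
  notPeak y∈ z∉ y+1∉ z≢1 y+1≢n = noPeak (suc z) (∈ᵇ⇒∈ y∈) (z∉ ∘ ∈⇒∈ᵇ) (y+1∉ ∘ ∈⇒∈ᵇ)
    (s≤s (s≤s (n≢0⇒n>0 (z≢1 ∘ ≡⇒≡ᵇ w 0))))
    (subst (_≤ n) (cong suc (sym (+-comm z 2))) (≤∧≢⇒< y<n (y+1≢n ∘ ≡⇒≡ᵇ _ _)))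

shadow-dual-at : ∀ {α γ x} → NoInternalPeak α → ShiftedComp γ → size γ ≡ size α →
  T (isCut γ x) → inShadowᵇ x (dual α) ≡ isCut α x
shadow-dual-at noPeak (γ-comp , γ-shifted) n≡ x∈ =
  shadow-dual noPeak (isCut-shifted γ-comp γ-shifted x∈)
    (subst (_ <_) n≡ (proj₂ (isCut-bounds γ-comp x∈)))

covered-dual : ∀ {α γ} → NoInternalPeak α → ShiftedComp γ → size γ ≡ size α →
  T (covered γ (dual α)) ⇔ (T ∘ isCut γ U.⊆ T ∘ isCut α)
covered-dual {α} {γ} noPeak sc n≡ = mk⇔
  (λ cov {x} x∈ → subst T (shadow-dual-at noPeak sc n≡ x∈) (All.lookup (all⁺ _ (I γ) cov) (∈ᵇ⇒∈ x∈)))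
  (λ sub → all⁻ (λ i → inShadowᵇ i (dual α)) (All.tabulate λ {x} x∈ →
    subst T (sym (shadow-dual-at noPeak sc n≡ (∈⇒∈ᵇ {xs = I γ} x∈))) (sub (∈⇒∈ᵇ x∈))))

θ-dual-self : ∀ {α} → Basic α → θ α (dual α) ≢ 0ℤ
θ-dual-self {α} (α-comp , α-shifted , noPeak) θ≡0 =
  <⇒≢ (m^n>0 2 (length (dual α)))
      (sym (ℤ.+-injective (trans (sym (if-true (Equivalence.from T-∧ (same-size , cov)))) θ≡0)))
  where
  same-size : T (size α ≡ᵇ size (dual α))
  same-size = ≡⇒≡ᵇ _ _ (sym (size-fromCuts (size α) (dualCut α)))
  cov : T (covered α (dual α))
  cov = Equivalence.from (covered-dual noPeak (α-comp , α-shifted) refl) id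

θ-dual-support : ∀ {α γ} → NoInternalPeak α → ShiftedComp γ → θ γ (dual α) ≢ 0ℤ →
  size γ ≡ size α × (T ∘ isCut γ U.⊆ T ∘ isCut α)
θ-dual-support {α} {γ} noPeak sc θ≢0 = n≡ , Equivalence.to (covered-dual noPeak sc n≡) (proj₂ conditions)
  where
  conditions : T (size γ ≡ᵇ size (dual α)) × T (covered γ (dual α))
  conditions = Equivalence.to T-∧ (if≢else θ≢0)
  n≡ : size γ ≡ size α
  n≡ = trans (≡ᵇ⇒≡ _ _ (proj₁ conditions)) (size-fromCuts (size α) (dualCut α))

⊆-cuts-< : ∀ {γ α} → IsComp γ → IsComp α → size γ ≡ size α →
  T ∘ isCut γ U.⊆ T ∘ isCut α → γ ≢ α → cuts γ < cuts α
⊆-cuts-< {γ} {α} γ-comp α-comp n≡ sub γ≢α = ≤∧≢⇒< at-most (γ≢α ∘ same-cuts⇒≡)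
  where
  cuts-γ≡ : cuts γ ≡ count (isCut γ) (size α)
  cuts-γ≡ = cong (count (isCut γ)) n≡
  at-most : cuts γ ≤ cuts α
  at-most = subst (_≤ cuts α) (sym cuts-γ≡) (count-mono (size α) sub)
  same-cuts⇒≡ : cuts γ ≡ cuts α → γ ≡ α
  same-cuts⇒≡ same = isCut-injective γ-comp α-comp n≡ λ x → T-ext sub λ x∈α →
    count-≡⇒⊇ sub (trans (sym cuts-γ≡) same) (proj₂ (isCut-bounds α-comp x∈α)) x∈α

dual-triangular : ∀ {α γ} → Basic α → ShiftedComp γ → γ ≢ α → θ γ (dual α) ≢ 0ℤ → cuts γ < cuts α
dual-triangular (α-comp , _ , noPeak) sc γ≢α θ≢0 =
  let n≡ , sub = θ-dual-support noPeak sc θ≢0 in ⊆-cuts-< (proj₁ sc) α-comp n≡ sub γ≢α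

lincomb-vanishes : ∀ {L β} → (∀ {p} → p ∈ L → proj₁ p *ℤ θ (proj₂ p) β ≡ 0ℤ) → lincomb L β ≡ 0ℤ
lincomb-vanishes {[]}    _     = refl
lincomb-vanishes {p ∷ L} {β} terms =
  cong₂ _+ℤ_ (terms (here refl)) (lincomb-vanishes {L} {β} (λ q∈ → terms (there q∈)))

lincomb-single : ∀ {L c α} β → Unique (map proj₂ L) → (c , α) ∈ L →
  (∀ {p} → p ∈ L → proj₂ p ≢ α → proj₁ p *ℤ θ (proj₂ p) β ≡ 0ℤ) → lincomb L β ≡ c *ℤ θ α β
lincomb-single {p ∷ L} β (α∉ ∷ _) (here refl) others =
  trans (cong (proj₁ p *ℤ θ (proj₂ p) β +ℤ_) (lincomb-vanishes {L} {β} λ q∈ →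
           others (there q∈) λ eq → All.lookup α∉ (∈-map⁺ proj₂ q∈) (sym eq)))
        (ℤ.+-identityʳ _)
lincomb-single {p ∷ L} β (p∉ ∷ unique) (there c,α∈) others =
  trans (cong (_+ℤ lincomb L β) (others (here refl) (All.lookup p∉ (∈-map⁺ proj₂ c,α∈))))
        (trans (ℤ.+-identityˡ _) (lincomb-single β unique c,α∈ (λ q∈ → others (there q∈))))

coefficients-vanish : ∀ L → All (λ p → Basic (proj₂ p)) L → Unique (map proj₂ L) →
  (∀ β → IsComp β → lincomb L β ≡ 0ℤ) → All (λ p → proj₁ p ≡ 0ℤ) L
coefficients-vanish L basic unique vanishes =
  All.tabulate λ {p} p∈L → go p∈L (<-wellFounded (cuts (proj₂ p)))
  where
  go : ∀ {c α} → (c , α) ∈ L → Acc _<_ (cuts α) → c ≡ 0ℤ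
  go {c} {α} c,α∈L (acc rec) =
    [ id , ⊥-elim ∘ θ-dual-self (All.lookup basic c,α∈L) ]′ (ℤ.i*j≡0⇒i≡0∨j≡0 c c·θ≡0)
    where
    others : ∀ {q} → q ∈ L → proj₂ q ≢ α → proj₁ q *ℤ θ (proj₂ q) (dual α) ≡ 0ℤ
    others {c′ , γ} q∈L γ≢α with θ γ (dual α) ℤ.≟ 0ℤ
    ... | yes θ≡0 = trans (cong (c′ *ℤ_) θ≡0) (ℤ.*-zeroʳ c′)
    ... | no  θ≢0 = cong (_*ℤ θ γ (dual α)) (go q∈L (rec
          (dual-triangular (All.lookup basic c,α∈L) (map₂ proj₁ (All.lookup basic q∈L)) γ≢α θ≢0)))
    c·θ≡0 : c *ℤ θ α (dual α) ≡ 0ℤ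
    c·θ≡0 = trans (sym (lincomb-single (dual α) unique c,α∈L others))
                  (vanishes (dual α) (isComp-fromCuts (size α) (dualCut α)))

theorem4p2 : ((L : List (ℤ × List ℕ)) → All (λ p → ShiftedComp (proj₂ p)) L →
    ∃[ L′ ] (All (λ p → Basic (proj₂ p)) L′ ×
      ((β : List ℕ) → IsComp β → lincomb L β ≡ lincomb L′ β)))
    ×
    ((L : List (ℤ × List ℕ)) → All (λ p → Basic (proj₂ p)) L →
      Unique (map proj₂ L) →
      ((β : List ℕ) → IsComp β → lincomb L β ≡ 0ℤ) →
      All (λ p → proj₁ p ≡ 0ℤ) L)
theorem4p2 =
  (λ L shifted → let L′ , basic , same = lincomb-spanned L shifted in L′ , basic , λ β _ → same β)
  , coefficients-vanish
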